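{- There are infinitely many positive integers $n$ such that $n \mid \sum_{i=1}^{n} F_i$, where $(F_n)_{n\ge 0}$ is the Fibonacci sequence.
   Context: The Fibonacci numbers are defined by $F_0=0$, $F_1=1$, and $F_{n+1}=F_n+F_{n-1}$ for $n\ge 1$. -}

module Defs where

open import Data.Nat using (ℕ; zero; suc; _+_)

fib : ℕ → ℕ
fib zero = 0
fib (suc zero) = 1
fib (suc (suc n)) = fib (suc n) + fib n

fibSum : ℕ → ℕ
fibSum zero = 0
fibSum (suc n) = fibSum n + fib (suc n)

module Submission where

-- The witnesses are n = 4K with K = 6·2ʲ.  Two independent facts combine:
--
--  * Sum side.  Since F₁ + ⋯ + Fₙ = F₍ₙ₊₂₎ − 1, the addition formula
--    F₍ₘ₊ₙ₊₁₎ = F₍ₘ₊₁₎F₍ₙ₊₁₎ + FₘFₙ together with Cassini's identity at an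
--    even index, F₂ₖF₂ₖ₊₂ + 1 = F₂ₖ₊₁², give
--    F₁ + ⋯ + F₄ₖ = F₂ₖ (F₂ₖ + 3F₂ₖ₊₁), so  F₂ₖ ∣ F₁ + ⋯ + F₄ₖ.
--
--  * Doubling.  From F₂ₘ = Fₘ (Fₘ + 2Fₘ₋₁): if 2N ∣ F_N then 4N ∣ F₂N,
--    because the second factor is even as soon as F_N is.  Starting from
--    24 ∣ F₁₂ = 144 this yields 4K ∣ F₂ₖ for every K = 6·2ʲ.
--
-- Hence 4K ∣ F₂ₖ ∣ F₁ + ⋯ + F₄ₖ, and K grows without bound.

open import Defs
open import Data.Nat using (ℕ; zero; suc; _+_; _*_; _<_; z≤n; s≤s)
open import Data.Nat.Properties using (+-suc; +-cancelʳ-≡; +-mono-≤; ≤-trans; <-≤-trans; m≤m+n)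
open import Data.Nat.Divisibility using (_∣_; divides; ∣-trans; ∣-reflexive; ∣m∣n⇒∣m+n; m∣m*n; *-pres-∣)
open import Data.Nat.Tactic.RingSolver using (solve-∀)
open import Data.Product using (∃-syntax; _×_; _,_)
open import Relation.Binary.PropositionalEquality using (_≡_; refl; sym; cong; module ≡-Reasoning)
open ≡-Reasoning

fibSum+1 : ∀ n → fibSum n + 1 ≡ fib (suc (suc n))
fibSum+1 zero = refl
fibSum+1 (suc n) = begin
  fibSum n + fib (suc n) + 1    ≡⟨ shuffle (fibSum n) (fib (suc n)) ⟩
  fib (suc n) + (fibSum n + 1)  ≡⟨ cong (fib (suc n) +_) (fibSum+1 n) ⟩
  fib (suc n) + fib (suc (suc n)) ≡⟨ swap (fib (suc n)) (fib (suc (suc n))) ⟩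
  fib (suc (suc n)) + fib (suc n) ∎
  where
  shuffle : ∀ x y → x + y + 1 ≡ y + (x + 1)
  shuffle = solve-∀
  swap : ∀ x y → x + y ≡ y + x
  swap = solve-∀

fib-add : ∀ m n → fib (suc (m + n)) ≡ fib (suc m) * fib (suc n) + fib m * fib n
fib-add zero n = sym (unit (fib (suc n)) (fib n))
  where
  unit : ∀ x y → 1 * x + 0 * y ≡ x
  unit = solve-∀
fib-add (suc m) n = begin
  fib (suc (suc (m + n)))  ≡⟨ cong (λ k → fib (suc k)) (sym (+-suc m n)) ⟩
  fib (suc (m + suc n))    ≡⟨ fib-add m (suc n) ⟩
  fib (suc m) * (fib (suc n) + fib n) + fib m * fib (suc n)
    ≡⟨ regroup (fib (suc m)) (fib m) (fib (suc n)) (fib n) ⟩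
  (fib (suc m) + fib m) * fib (suc n) + fib (suc m) * fib n ∎
  where
  regroup : ∀ a b c d → a * (c + d) + b * c ≡ (a + b) * c + a * d
  regroup = solve-∀

fib-double : ∀ m → fib (suc m + suc m) ≡ fib (suc m) * (fib (suc m) + 2 * fib m)
fib-double m = begin
  fib (suc (m + suc m))  ≡⟨ cong (λ k → fib (suc k)) (+-suc m m) ⟩
  fib (suc (suc m + m))  ≡⟨ fib-add (suc m) m ⟩
  (b + a) * b + b * a    ≡⟨ factor a b ⟩
  b * (b + 2 * a)        ∎
  where
  a : ℕ
  a = fib m
  b : ℕ
  b = fib (suc m)
  factor : ∀ a b → (b + a) * b + b * a ≡ b * (b + 2 * a)
  factor = solve-∀

-- One step of the Fibonacci recurrence flips the sign in Cassini's identity.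
-- With consecutive terms a, b, b + a, (b + a) + b:
-- a(b + a) + 1 = b²  implies  b((b + a) + b) = (b + a)² + 1, ...
cassini-flip⁻ : ∀ a b → a * (b + a) + 1 ≡ b * b → b * ((b + a) + b) ≡ (b + a) * (b + a) + 1
cassini-flip⁻ a b h = begin
  b * ((b + a) + b)                   ≡⟨ expand a b ⟩
  b * b + a * b + b * b               ≡⟨ cong (b * b + a * b +_) (sym h) ⟩
  b * b + a * b + (a * (b + a) + 1)   ≡⟨ square a b ⟩
  (b + a) * (b + a) + 1               ∎
  where
  expand : ∀ a b → b * ((b + a) + b) ≡ b * b + a * b + b * b
  expand = solve-∀
  square : ∀ a b → b * b + a * b + (a * (b + a) + 1) ≡ (b + a) * (b + a) + 1
  square = solve-∀

cassini-flip⁺ : ∀ a b → a * (b + a) ≡ b * b + 1 → b * ((b + a) + b) + 1 ≡ (b + a) * (b + a)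
cassini-flip⁺ a b h = begin
  b * ((b + a) + b) + 1          ≡⟨ expand a b ⟩
  b * b + a * b + (b * b + 1)    ≡⟨ cong (b * b + a * b +_) (sym h) ⟩
  b * b + a * b + a * (b + a)    ≡⟨ square a b ⟩
  (b + a) * (b + a)              ∎
  where
  expand : ∀ a b → b * ((b + a) + b) + 1 ≡ b * b + a * b + (b * b + 1)
  expand = solve-∀
  square : ∀ a b → b * b + a * b + a * (b + a) ≡ (b + a) * (b + a)
  square = solve-∀

cassini-even : ∀ k → fib (k + k) * fib (suc (suc (k + k))) + 1 ≡ fib (suc (k + k)) * fib (suc (k + k))
cassini-odd : ∀ k → fib (suc (k + k)) * fib (suc (suc (suc (k + k))))
                    ≡ fib (suc (suc (k + k))) * fib (suc (suc (k + k))) + 1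

cassini-even zero = refl
cassini-even (suc k) rewrite +-suc k k =
  cassini-flip⁺ (fib (suc (k + k))) (fib (suc (suc (k + k)))) (cassini-odd k)

cassini-odd k = cassini-flip⁻ (fib (k + k)) (fib (suc (k + k))) (cassini-even k)

fibSum-quadruple : ∀ k → let X = k + k in
  fibSum (X + X) ≡ fib X * (fib X + 3 * fib (suc X))
fibSum-quadruple k = +-cancelʳ-≡ 1 _ _ (begin
  fibSum (X + X) + 1                 ≡⟨ fibSum+1 (X + X) ⟩
  fib (suc (suc X + X))              ≡⟨ fib-add (suc X) X ⟩
  (b + a) * b + b * a                ≡⟨ expand a b ⟩
  b * b + 2 * (a * b)                ≡⟨ cong (_+ 2 * (a * b)) (sym (cassini-even k)) ⟩
  a * (b + a) + 1 + 2 * (a * b)      ≡⟨ factor a b ⟩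
  a * (a + 3 * b) + 1                ∎)
  where
  X : ℕ
  X = k + k
  a : ℕ
  a = fib X
  b : ℕ
  b = fib (suc X)
  expand : ∀ a b → (b + a) * b + b * a ≡ b * b + 2 * (a * b)
  expand = solve-∀
  factor : ∀ a b → a * (b + a) + 1 + 2 * (a * b) ≡ a * (a + 3 * b) + 1
  factor = solve-∀

fib-even∣fibSum : ∀ k → fib (k + k) ∣ fibSum ((k + k) + (k + k))
fib-even∣fibSum k = ∣-trans (m∣m*n _) (∣-reflexive (sym (fibSum-quadruple k)))

-- Doubling: if 2N ∣ F_N (N ≥ 1) then 4N ∣ F₂N.  In F₂N = F_N (F_N + 2F₍N₋₁₎)
-- the first factor is divisible by 2N, the second by 2 since F_N is even.
double-divides : ∀ N → 0 < N → N + N ∣ fib N → (N + N) + (N + N) ∣ fib (N + N)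
double-divides (suc m) _ 2N∣F = ∣-trans (∣-reflexive (twice (suc m)))
  (∣-trans 4N∣product (∣-reflexive (sym (fib-double m))))
  where
  twice : ∀ x → (x + x) + (x + x) ≡ (x + x) * 2
  twice = solve-∀
  double : ∀ x → x + x ≡ x * 2
  double = solve-∀
  2∣F : 2 ∣ fib (suc m) + 2 * fib m
  2∣F = ∣m∣n⇒∣m+n (∣-trans (divides (suc m) (double (suc m))) 2N∣F) (m∣m*n (fib m))
  4N∣product : (suc m + suc m) * 2 ∣ fib (suc m) * (fib (suc m) + 2 * fib m)
  4N∣product = *-pres-∣ 2N∣F 2∣F

sixTimesPow2 : ℕ → ℕ
sixTimesPow2 zero = 6
sixTimesPow2 (suc j) = sixTimesPow2 j + sixTimesPow2 j

sixTimesPow2-grows : ∀ j → j < sixTimesPow2 j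
sixTimesPow2-grows zero = s≤s z≤n
sixTimesPow2-grows (suc j) = +-mono-≤ (≤-trans (s≤s z≤n) j<K) j<K
  where
  j<K : j < sixTimesPow2 j
  j<K = sixTimesPow2-grows j

sixTimesPow2-divides : ∀ j → let K = sixTimesPow2 j in (K + K) + (K + K) ∣ fib (K + K)
sixTimesPow2-divides zero = divides 6 refl
sixTimesPow2-divides (suc j) =
  double-divides (K + K) (≤-trans 0<K (m≤m+n K K)) (sixTimesPow2-divides j)
  where
  K : ℕ
  K = sixTimesPow2 j
  0<K : 0 < K
  0<K = ≤-trans (s≤s z≤n) (sixTimesPow2-grows j)

mainTheorem4 : ∀ (m : ℕ) → ∃[ n ] (m < n × 0 < n × n ∣ fibSum n)
mainTheorem4 m = n , m<n , ≤-trans (s≤s z≤n) m<n , n∣fibSum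
  where
  K : ℕ
  K = sixTimesPow2 m
  n : ℕ
  n = (K + K) + (K + K)
  m<n : m < n
  m<n = <-≤-trans (sixTimesPow2-grows m) (≤-trans (m≤m+n K K) (m≤m+n (K + K) (K + K)))
  n∣fibSum : n ∣ fibSum n
  n∣fibSum = ∣-trans (sixTimesPow2-divides m) (fib-even∣fibSum K)
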